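{- Let $\mathcal K$ be a $d$-dimensional simplicial complex and $\mathcal V$ a gradient vector field on it. Then for each $0\le q\le d$, the set \[\widetilde S_q^{(\mathcal V)}=\{\overrightarrow{\sigma}^{(\mathcal V)}:\sigma\in\operatorname{Crit}^{(\mathcal V)}_q(\mathcal K)\}\ \cup\ \{\partial_{q+1}(\mathcal V(\alpha)):\alpha\in U_q^{(\mathcal V)}\}\ \cup\ D_q^{(\mathcal V)}\] is a $\mathbb Z$-basis of $C_q(\mathcal K,\mathbb Z)$.
   Context: A simplicial complex $\mathcal K$ is a finite nonempty collection of finite sets closed under subsets (so $\emptyset\in\mathcal K$); $\dim\sigma=|\sigma|-1$; $\alpha$ is a facet of $\beta$ if $\alpha\subseteq\beta$ and $\dim\alpha=\dim\beta-1$. A total order on the vertices is fixed; a $q$-simplex with vertices $x_0<\dots<x_q$ is the oriented simplex $[x_0,\dots,x_q]$; $C_q(\mathcal K,\mathbb Z)$ is the free $\mathbb Z$-module with basis the set $S_q$ of $q$-simplices. For a $q$-simplex $\sigma=[x_0,\dots,x_q]$ and a $(q-1)$-simplex $\tau$ ($\tau=\emptyset$ if $q=0$), $[\sigma,\tau]=(-1)^i$ if $\tau=\sigma\setminus\{x_i\}$, $0$ if $\tau\not\subseteq\sigma$; $\partial_q\sigma=\sum_{\tau\in S_{q-1}}[\sigma,\tau]\tau$ for $q\ge1$, $\partial_0=0$. A discrete vector field $\mathcal V$ is a set of pairs $(\alpha,\beta)$ of simplices ($\alpha=\emptyset$ allowed) with $\alpha$ a facet of $\beta$, each simplex in at most one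 pair; write $\mathcal V(\alpha)=\beta$ when $(\alpha,\beta)\in\mathcal V$. A $\mathcal V$-trajectory $P:\beta_0,\alpha_1,\beta_1,\dots,\alpha_r,\beta_r$ ($r\ge0$) consists of alternately $q$- and $(q-1)$-simplices with $(\alpha_i,\beta_i)\in\mathcal V$, $\alpha_i\subsetneq\beta_{i-1}$, $\beta_{i-1}\ne\beta_i$; $\mathbf i(P)=\beta_0$, $\mathbf t(P)=\beta_r$, $w(P)=\prod_{i=1}^r(-[\beta_{i-1},\alpha_i][\beta_i,\alpha_i])$ ($1$ if $r=0$); nontrivial closed if $r>0$ and $\beta_r=\beta_0$. A gradient vector field has no nontrivial closed trajectory. A nonempty simplex $\sigma$ is critical if it lies in no pair, or is a $0$-simplex with $(\emptyset,\sigma)\in\mathcal V$; $\operatorname{Crit}_q^{(\mathcal V)}(\mathcal K)$ is the set of critical $q$-simplices. $U_q^{(\mathcal V)}$ is the set of $q$-simplices $\alpha$ with $(\alpha,\beta)\in\mathcal V$ for some $\beta$; $D_q^{(\mathcal V)}$ is the set of non-critical $q$-simplices $\beta$ with $(\alpha,\beta)\in\mathcal V$ for some $\alpha$. For $\sigma$ critical, $\overrightarrow{\sigma}^{(\mathcal V)}=\sum_{P:\ \mathbf i(P)=\sigma}w(P)\,\mathbf t(P)$, summed over all $\mathcal V$-trajectories starting at $\sigma$. -}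

module Defs where

open import Data.Bool using (Bool; true; false; if_then_else_; _∧_; not)
open import Data.Nat as ℕ using (ℕ; zero; suc; _<_; _≤_)
open import Data.Integer as ℤ using (ℤ; +_; -_; _*_; _+_; _^_)
open import Data.Fin using (Fin; toℕ)
open import Data.Product using (Σ; ∃; _×_; _,_; proj₁; proj₂)
open import Data.Sum using (_⊎_)
open import Data.List using (List; []; _∷_; length; filter; map; concatMap; foldr; _++_; removeAt; lookup; last)
open import Data.List.Properties using (≡-dec)
open import Data.List.Membership.Propositional using (_∈_; _∉_)
import Data.List.Membership.DecPropositional as MemDec
open import Data.List.Relation.Unary.Any using (Any; any?)
open import Data.List.Relation.Unary.All using (All; all?)
open import Data.List.Relation.Unary.AllPairs using (AllPairs)
open import Data.List.Relation.Unary.Unique.Propositional using (Unique)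
open import Data.List.Relation.Binary.Sublist.DecPropositional (ℕ._≟_) using (_⊆_; _⊆?_)
open import Relation.Binary.PropositionalEquality using (_≡_; _≢_)
open import Relation.Nullary using (¬_; Dec; does; _×-dec_; ¬?)
open import Relation.Binary.Definitions using (DecidableEquality)

-- A simplex is represented by the strictly increasing list of its
-- vertices x₀ < … < x_q, i.e. the oriented simplex [x₀,…,x_q].
-- The empty list is the empty simplex ∅.

Simplex : Set
Simplex = List ℕ

_≟ₛ_ : DecidableEquality Simplex
_≟ₛ_ = ≡-dec ℕ._≟_

_∈?ₛ_ : (σ : Simplex) (L : List Simplex) → Dec (σ ∈ L)
_∈?ₛ_ = MemDec._∈?_ _≟ₛ_

IsSimplex : Simplex → Set
IsSimplex σ = AllPairs _<_ σ

-- For strictly increasing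
-- lists, "τ is a subset of σ" is exactly "τ is a sublist of σ".
record IsComplex (K : List Simplex) : Set where
  field
    simplices : All IsSimplex K
    noDup     : Unique K
    nonempty  : ∃ λ σ → σ ∈ K
    closed    : ∀ {σ τ} → σ ∈ K → τ ⊆ σ → τ ∈ K

HasDim : List Simplex → ℕ → Set
HasDim K d = (∃ λ σ → σ ∈ K × length σ ≡ suc d) × (∀ σ → σ ∈ K → length σ ≤ suc d)

Σℤ : (n : ℕ) → (Fin n → ℤ) → ℤ
Σℤ zero    f = + 0
Σℤ (suc n) f = f Fin.zero + Σℤ n (λ i → f (Fin.suc i))
  where import Data.Fin as Fin

sumℤ : List ℤ → ℤ
sumℤ = foldr _+_ (+ 0)

prodℤ : List ℤ → ℤ
prodℤ = foldr _*_ (+ 1)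

incidence : Simplex → Simplex → ℤ
incidence σ τ =
  Σℤ (length σ) (λ i → if does (τ ≟ₛ removeAt σ i) then (- (+ 1)) ^ toℕ i else + 0)

-- Chains.  A chain is a function assigning an integer coefficient to each
-- simplex (the formal sum Σ c(τ) τ).  C_q(K,ℤ) consists of the chains
-- supported on S_q, the set of q-simplices of K.

Chain : Set
Chain = Simplex → ℤ

S : List Simplex → ℕ → List Simplex
S K q = filter (λ σ → length σ ℕ.≟ suc q) K

SupportedOn : List Simplex → Chain → Set
SupportedOn L c = ∀ τ → τ ∉ L → c τ ≡ + 0

unitChain : Simplex → Chain
unitChain σ τ = if does (σ ≟ₛ τ) then + 1 else + 0

-- ∂_{q+1} β = Σ_{τ ∈ S_q} [β, τ] τ   (used for q+1 ≥ 1)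
boundary : List Simplex → ℕ → Simplex → Chain
boundary K q β τ = if does (τ ∈?ₛ S K q) then incidence β τ else + 0

-- A list of chains bs is a ℤ-basis of the free ℤ-module of chains
-- supported on L: all its members lie in that module, they span it,
-- and they are linearly independent (as the family indexed by
-- positions in the list).
IsBasis : List Simplex → List Chain → Set
IsBasis L bs =
  All (SupportedOn L) bs ×
  (∀ (c : Chain) → SupportedOn L c →
     ∃ λ (λs : Fin (length bs) → ℤ) →
       ∀ τ → c τ ≡ Σℤ (length bs) (λ i → λs i * lookup bs i τ)) ×
  (∀ (λs : Fin (length bs) → ℤ) →
     (∀ τ → Σℤ (length bs) (λ i → λs i * lookup bs i τ) ≡ + 0) →
     ∀ i → λs i ≡ + 0)

-- Discrete vector fields: a duplicate-free list of pairs (α, β) of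
-- simplices of K with α a facet of β (α = ∅ allowed), every simplex
-- occurring in at most one pair.

Pair : Set
Pair = Simplex × Simplex

IsFacet : Simplex → Simplex → Set
IsFacet α β = α ⊆ β × length β ≡ suc (length α)

record IsDVF (K : List Simplex) (V : List Pair) : Set where
  field
    inK     : All (λ p → proj₁ p ∈ K × proj₂ p ∈ K) V
    facet   : All (λ p → IsFacet (proj₁ p) (proj₂ p)) V
    noDup   : Unique V
    atMostOne : ∀ {p p'} → p ∈ V → p' ∈ V →
      (proj₁ p ≡ proj₁ p' ⊎ proj₁ p ≡ proj₂ p' ⊎ proj₂ p ≡ proj₁ p' ⊎ proj₂ p ≡ proj₂ p') →
      p ≡ p'

-- V-trajectories  β₀, α₁, β₁, …, α_r, β_r  are represented by β₀ together
-- with the list of pairs (α₁,β₁), …, (α_r,β_r).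

StepOK : Simplex → Pair → Set
StepOK β (α , β') = α ⊆ β × α ≢ β × β ≢ β' × length β' ≡ length β

stepOK? : (β : Simplex) (p : Pair) → Dec (StepOK β p)
stepOK? β (α , β') =
  (α ⊆? β) ×-dec ¬? (α ≟ₛ β) ×-dec ¬? (β ≟ₛ β') ×-dec (length β' ℕ.≟ length β)

IsTrajectory : List Pair → Simplex → List Pair → Set
IsTrajectory V β₀ []             = Data.Unit.⊤ where import Data.Unit
IsTrajectory V β₀ ((α , β) ∷ ps) = (α , β) ∈ V × StepOK β₀ (α , β) × IsTrajectory V β ps

terminal : Simplex → List Pair → Simplex
terminal β₀ []             = β₀
terminal β₀ ((α , β) ∷ ps) = terminal β ps

weight : Simplex → List Pair → ℤ
weight β₀ []             = + 1
weight β₀ ((α , β) ∷ ps) = (- (incidence β₀ α * incidence β α)) * weight β ps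

IsGradient : List Pair → Set
IsGradient V = ∀ β₀ p ps → IsTrajectory V β₀ (p ∷ ps) → terminal β₀ (p ∷ ps) ≢ β₀

trajectories : List Pair → ℕ → Simplex → List (List Pair)
trajectories V zero    β = [] ∷ []
trajectories V (suc n) β =
  [] ∷ concatMap (λ p → map (p ∷_) (trajectories V n (proj₂ p))) (filter (stepOK? β) V)

-- For a gradient field every trajectory
-- has at most |V| steps (its β₁,…,β_r are distinct second components of
-- pairs of V), so the trajectories with ≤ |V| steps are all of them.
arrow : List Pair → Simplex → Chain
arrow V σ τ =
  sumℤ (map (λ ps → if does (terminal σ ps ≟ₛ τ) then weight σ ps else + 0)
            (trajectories V (length V) σ))

InNoPair : List Pair → Simplex → Set
InNoPair V σ = All (λ p → proj₁ p ≢ σ × proj₂ p ≢ σ) V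

Critical : List Pair → Simplex → Set
Critical V σ = σ ≢ [] × (InNoPair V σ ⊎ (length σ ≡ 1 × ([] , σ) ∈ V))

critical? : (V : List Pair) (σ : Simplex) → Dec (Critical V σ)
critical? V σ =
  ¬? (σ ≟ₛ []) ×-dec
  (all? (λ p → ¬? (proj₁ p ≟ₛ σ) ×-dec ¬? (proj₂ p ≟ₛ σ)) V
     ⊎-dec ((length σ ℕ.≟ 1) ×-dec MemDec._∈?_ (Data.Product.Properties.≡-dec _≟ₛ_ _≟ₛ_) ([] , σ) V))
  where
    open import Relation.Nullary using (_⊎-dec_)
    import Data.Product.Properties

Crit : List Simplex → List Pair → ℕ → List Simplex
Crit K V q = filter (critical? V) (S K q)

U : List Simplex → List Pair → ℕ → List Simplex
U K V q = filter (λ α → any? (λ p → proj₁ p ≟ₛ α) V) (S K q)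

D : List Simplex → List Pair → ℕ → List Simplex
D K V q = filter (λ β → ¬? (critical? V β) ×-dec any? (λ p → proj₂ p ≟ₛ β) V) (S K q)

-- V(α): the β with (α, β) ∈ V (well defined by IsDVF.atMostOne;
-- only used for α ∈ U_q)
Vof : List Pair → Simplex → Simplex
Vof V α = foldr (λ p r → if does (proj₁ p ≟ₛ α) then proj₂ p else r) [] V

Stilde : List Simplex → List Pair → ℕ → List Chain
Stilde K V q =
  map (arrow V) (Crit K V q) ++
  map (λ α → boundary K q (Vof V α)) (U K V q) ++
  map unitChain (D K V q)

{-# OPTIONS --safe #-}
module Submission where

-- Every member of S̃_q has a pivot q-simplex — σ for σ⃗, α for ∂(V α), β for β ∈ D_q — at which
-- its coefficient is ±1, and every q-simplex is the pivot of exactly one member.  Away from its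
-- pivot a member lives on q-simplices strictly below the pivot for the order that puts targets of
-- V below unpaired simplices below sources of V, and compares two sources α, τ by whether a
-- nontrivial V-trajectory runs from V α to V τ; this is a strict order because V is gradient.
-- A family that is unitriangular for a strict order on its finitely many pivots is a ℤ-basis:
-- spanning and independence both follow by well-founded induction along the order.

open import Defs
open import Data.Nat using (ℕ; _≤_)
open import Data.List using (List)

open import Data.Nat as ℕ using (zero; suc; _<_)
import Data.Nat.Properties as ℕ
open import Data.Bool using (if_then_else_)
open import Data.Fin as Fin using (Fin; zero; suc; toℕ)
import Data.Fin.Properties as Fin
open import Data.Fin.Induction using (spo-wellFounded; spo-noetherian)
open import Data.Integer as ℤ using (ℤ; +_; -_; _*_; _+_; _-_; _^_)
import Data.Integer.Properties as ℤ
open import Data.Integer.Tactic.RingSolver using (solve-∀)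
open import Data.List using ([]; _∷_; _++_; length; lookup; map; filter; concatMap; removeAt)
open import Data.List.Membership.Propositional using (_∈_; find; lose)
open import Data.List.Membership.Propositional.Properties
  using (∈-map⁺; ∈-map⁻; ∈-++⁺ˡ; ∈-++⁺ʳ; ∈-++⁻; ∈-concatMap⁻; ∈-filter⁺; ∈-filter⁻; map∷⁻)
open import Data.List.Properties using (∷-injectiveˡ; ∷-injectiveʳ; map-∘; map-id; map-++)
open import Data.List.Relation.Binary.Disjoint.Propositional using (Disjoint)
open import Data.List.Relation.Binary.Pointwise using (Pointwise-≡⇒≡)
open import Data.List.Relation.Binary.Sublist.DecPropositional (ℕ._≟_) using (_⊆_; ⊆-refl)
open import Data.List.Relation.Binary.Sublist.Heterogeneous using (_∷_; _∷ʳ_)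
open import Data.List.Relation.Binary.Sublist.Heterogeneous.Properties using (toPointwise)
open import Data.List.Relation.Unary.All as All using (All; []; _∷_)
import Data.List.Relation.Unary.All.Properties as All
open import Data.List.Relation.Unary.AllPairs using ([]; _∷_)
open import Data.List.Relation.Unary.Any using (Any; here; there; any?)
open import Data.List.Relation.Unary.Unique.Propositional using (Unique)
import Data.List.Relation.Unary.Unique.Propositional.Properties as Unique
open import Data.Product using (∃; ∃₂; _×_; _,_; proj₁; proj₂)
open import Data.Product.Relation.Binary.Lex.Strict using (×-Lex; ×-isStrictPartialOrder)
open import Data.Product.Relation.Binary.Pointwise.NonDependent using (Pointwise)
open import Data.Sum using (inj₁; inj₂)
open import Data.Unit using (tt)
open import Function using (id; _∘_; flip; _on_)
open import Induction.WellFounded using (Acc; acc)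
open import Level using (0ℓ)
open import Relation.Binary using (Rel; IsStrictPartialOrder; Transitive)
import Relation.Binary.Construct.Flip.EqAndOrd as Flip
import Relation.Binary.Construct.On as On
open import Relation.Binary.PropositionalEquality
open import Relation.Nullary using (¬_; Dec; yes; no; does; ¬?; _×-dec_; contradiction)
open import Relation.Nullary.Decidable using (dec-true; dec-false)

Σℤ-cong : ∀ n {f g : Fin n → ℤ} → (∀ i → f i ≡ g i) → Σℤ n f ≡ Σℤ n g
Σℤ-cong zero    f≗g = refl
Σℤ-cong (suc n) f≗g = cong₂ _+_ (f≗g zero) (Σℤ-cong n (f≗g ∘ suc))

Σℤ-zero : ∀ n {f : Fin n → ℤ} → (∀ i → f i ≡ + 0) → Σℤ n f ≡ + 0
Σℤ-zero zero    f≗0 = refl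
Σℤ-zero (suc n) f≗0 = cong₂ _+_ (f≗0 zero) (Σℤ-zero n (f≗0 ∘ suc))

Σℤ-select : ∀ n {f : Fin n → ℤ} k → (∀ i → i ≢ k → f i ≡ + 0) → Σℤ n f ≡ f k
Σℤ-select (suc n) {f} zero    others≡0 =
  trans (cong (_+_ (f zero)) (Σℤ-zero n λ i → others≡0 (suc i) λ ()))
        (ℤ.+-identityʳ (f zero))
Σℤ-select (suc n) {f} (suc k) others≡0 =
  trans (cong₂ _+_ (others≡0 zero λ ())
                   (Σℤ-select n k λ i i≢k → others≡0 (suc i) (i≢k ∘ Fin.suc-injective)))
        (ℤ.+-identityˡ (f (suc k)))

Σℤ-distrib-+ : ∀ n (f g : Fin n → ℤ) → Σℤ n (λ i → f i + g i) ≡ Σℤ n f + Σℤ n g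
Σℤ-distrib-+ zero    f g = refl
Σℤ-distrib-+ (suc n) f g =
  trans (cong (_+_ (f zero + g zero)) (Σℤ-distrib-+ n (f ∘ suc) (g ∘ suc)))
        (interchange (f zero) (g zero) _ _)
  where
  interchange : ∀ a b c d → (a + b) + (c + d) ≡ (a + c) + (b + d)
  interchange = solve-∀

*-distribˡ-Σℤ : ∀ n a (f : Fin n → ℤ) → a * Σℤ n f ≡ Σℤ n (λ i → a * f i)
*-distribˡ-Σℤ zero    a f = ℤ.*-zeroʳ a
*-distribˡ-Σℤ (suc n) a f =
  trans (ℤ.*-distribˡ-+ a (f zero) _) (cong (_+_ (a * f zero)) (*-distribˡ-Σℤ n a (f ∘ suc)))

Σℤ-nonzero : ∀ n {f : Fin n → ℤ} → Σℤ n f ≢ + 0 → ∃ λ i → f i ≢ + 0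
Σℤ-nonzero n {f} Σ≢0 = Fin.¬∀⟶∃¬ n _ (λ i → f i ℤ.≟ + 0) (Σ≢0 ∘ Σℤ-zero n)

sumℤ-map-zero : ∀ {A : Set} {f : A → ℤ} {xs} → All (λ x → f x ≡ + 0) xs → sumℤ (map f xs) ≡ + 0
sumℤ-map-zero []           = refl
sumℤ-map-zero (fx≡0 ∷ all) = cong₂ _+_ fx≡0 (sumℤ-map-zero all)

sumℤ-map-nonzero : ∀ {A : Set} {f : A → ℤ} xs →
                   sumℤ (map f xs) ≢ + 0 → Any (λ x → f x ≢ + 0) xs
sumℤ-map-nonzero {f = f} xs sum≢0 =
  All.¬All⇒Any¬ (λ x → f x ℤ.≟ + 0) xs (sum≢0 ∘ sumℤ-map-zero)

module _ {a p} {A : Set a} {P : Set p} (P? : Dec P) {x y : A} where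

  if-dec-yes : P → (if does P? then x else y) ≡ x
  if-dec-yes p = cong (if_then x else y) (dec-true P? p)

  if-dec-no : ¬ P → (if does P? then x else y) ≡ y
  if-dec-no ¬p = cong (if_then x else y) (dec-false P? ¬p)

if-dec-nonzero : ∀ {p} {P : Set p} (P? : Dec P) {x : ℤ} →
                 (if does P? then x else + 0) ≢ + 0 → P
if-dec-nonzero (yes p) _  = p
if-dec-nonzero (no _)  ≢0 = contradiction refl ≢0

unitChain-diag : ∀ σ → unitChain σ σ ≡ + 1
unitChain-diag σ = if-dec-yes (σ ≟ₛ σ) refl

unitChain-offdiag : ∀ {σ τ} → σ ≢ τ → unitChain σ τ ≡ + 0
unitChain-offdiag {σ} {τ} = if-dec-no (σ ≟ₛ τ)

unitChain-scaled : ∀ (c : Chain) σ τ → c σ * unitChain σ τ ≡ c τ * unitChain σ τ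
unitChain-scaled c σ τ with σ ≟ₛ τ
... | yes refl = refl
... | no  _    = trans (ℤ.*-zeroʳ (c σ)) (sym (ℤ.*-zeroʳ (c τ)))

module _ {A B : Set} where

  pivot : (ps : List (A × B)) → Fin (length (map proj₂ ps)) → A
  pivot (p ∷ ps) zero    = proj₁ p
  pivot (p ∷ ps) (suc i) = pivot ps i

  pivot-entry : ∀ ps i → (pivot ps i , lookup (map proj₂ ps) i) ∈ ps
  pivot-entry (p ∷ ps) zero    = here refl
  pivot-entry (p ∷ ps) (suc i) = there (pivot-entry ps i)

  pivot-injective : ∀ ps → Unique (map proj₁ ps) →
                    ∀ {i j} → pivot ps i ≡ pivot ps j → i ≡ j
  pivot-injective (p ∷ ps) _        {zero}  {zero}  _  = refl
  pivot-injective (p ∷ ps) (p∉ ∷ _) {zero}  {suc j} eq =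
    contradiction eq (All.lookup p∉ (∈-map⁺ proj₁ (pivot-entry ps j)))
  pivot-injective (p ∷ ps) (p∉ ∷ _) {suc i} {zero}  eq =
    contradiction (sym eq) (All.lookup p∉ (∈-map⁺ proj₁ (pivot-entry ps i)))
  pivot-injective (p ∷ ps) (_ ∷ u)  {suc i} {suc j} eq = cong suc (pivot-injective ps u eq)

  pivot-surjective : ∀ ps {x} → x ∈ map proj₁ ps → ∃ λ i → pivot ps i ≡ x
  pivot-surjective (p ∷ ps) (here refl) = zero , refl
  pivot-surjective (p ∷ ps) (there x∈)  with pivot-surjective ps x∈
  ... | i , eq = suc i , eq

  tagged : (A → B) → List A → List (A × B)
  tagged f = map (λ x → x , f x)

  map-proj₁-tagged : ∀ (f : A → B) xs → map proj₁ (tagged f xs) ≡ xs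
  map-proj₁-tagged f xs = trans (sym (map-∘ xs)) (map-id xs)

  map-proj₂-tagged : ∀ (f : A → B) xs → map proj₂ (tagged f xs) ≡ map f xs
  map-proj₂-tagged f xs = sym (map-∘ xs)

  ∈-tagged⁻ : ∀ {f : A → B} {xs x c} → (x , c) ∈ tagged f xs → x ∈ xs × c ≡ f x
  ∈-tagged⁻ {f} x,c∈ with ∈-map⁻ (λ x → x , f x) x,c∈
  ... | x , x∈ , refl = x∈ , refl

record PivotedAt {ℓ} (L : List Simplex) (_≺_ : Rel Simplex ℓ) (σ : Simplex) (c : Chain) : Set ℓ
  where
  field
    supported     : SupportedOn L c
    unit-at-pivot : c σ * c σ ≡ + 1
    below-pivot   : ∀ τ → τ ≢ σ → c τ ≢ + 0 → τ ≺ σ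

module Unitriangular
  {ℓ₁ ℓ₂} {_≈_ : Rel Simplex ℓ₁} {_≺_ : Rel Simplex ℓ₂}
  (≺-isStrictPartialOrder : IsStrictPartialOrder _≈_ _≺_)
  (L : List Simplex) (ps : List (Simplex × Chain))
  (pivots-unique : Unique (map proj₁ ps))
  (pivots-cover  : ∀ {τ} → τ ∈ L → τ ∈ map proj₁ ps)
  (pivoted       : ∀ {σ c} → (σ , c) ∈ ps → PivotedAt L _≺_ σ c)
  where

  open ≡-Reasoning

  N : ℕ
  N = length (map proj₂ ps)

  b : Fin N → Chain
  b = lookup (map proj₂ ps)

  piv : Fin N → Simplex
  piv = pivot ps

  open module Entry i = PivotedAt (pivoted (pivot-entry ps i))

  piv-injective : ∀ {i j} → piv i ≡ piv j → i ≡ j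
  piv-injective = pivot-injective ps pivots-unique

  piv∈L : ∀ i → piv i ∈ L
  piv∈L i with piv i ∈?ₛ L
  ... | yes ∈L = ∈L
  ... | no  ∉L = contradiction
    (trans (sym (unit-at-pivot i)) (cong (λ x → x * x) (supported i (piv i) ∉L))) λ ()

  _⊏_ : Rel (Fin N) ℓ₂
  _⊏_ = _≺_ on piv

  ⊏-isStrictPartialOrder : IsStrictPartialOrder (_≈_ on piv) _⊏_
  ⊏-isStrictPartialOrder = On.isStrictPartialOrder piv ≺-isStrictPartialOrder

  InSpan : Chain → Set
  InSpan c = ∃ λ (λs : Fin N → ℤ) → ∀ τ → c τ ≡ Σℤ N (λ i → λs i * b i τ)

  span-resp : ∀ {c c′} → (∀ τ → c τ ≡ c′ τ) → InSpan c′ → InSpan c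
  span-resp c≗c′ (λs , c′≡) = λs , λ τ → trans (c≗c′ τ) (c′≡ τ)

  span-zero : InSpan (λ _ → + 0)
  span-zero = (λ _ → + 0) , λ τ → sym (Σℤ-zero N λ _ → refl)

  span-+ : ∀ {c c′} → InSpan c → InSpan c′ → InSpan (λ τ → c τ + c′ τ)
  span-+ {c} {c′} (λs , c≡) (λs′ , c′≡) = (λ i → λs i + λs′ i) , λ τ → begin
    c τ + c′ τ
      ≡⟨ cong₂ _+_ (c≡ τ) (c′≡ τ) ⟩
    Σℤ N (λ i → λs i * b i τ) + Σℤ N (λ i → λs′ i * b i τ)
      ≡⟨ Σℤ-distrib-+ N _ _ ⟨
    Σℤ N (λ i → λs i * b i τ + λs′ i * b i τ)
      ≡⟨ Σℤ-cong N (λ i → ℤ.*-distribʳ-+ (b i τ) (λs i) (λs′ i)) ⟨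
    Σℤ N (λ i → (λs i + λs′ i) * b i τ) ∎

  span-scale : ∀ a {c} → InSpan c → InSpan (λ τ → a * c τ)
  span-scale a (λs , c≡) = (λ i → a * λs i) , λ τ →
    trans (cong (a *_) (c≡ τ))
      (trans (*-distribˡ-Σℤ N a _) (Σℤ-cong N λ i → sym (ℤ.*-assoc a (λs i) (b i τ))))

  span-Σ : ∀ M (c : Fin M → Chain) → (∀ j → InSpan (c j)) →
           InSpan (λ τ → Σℤ M (λ j → c j τ))
  span-Σ zero    c spans = span-zero
  span-Σ (suc M) c spans = span-+ (spans zero) (span-Σ M (c ∘ suc) (spans ∘ suc))

  span-member : ∀ i → InSpan (b i)
  span-member i = δ , λ τ → sym (begin
    Σℤ N (λ j → δ j * b j τ)
      ≡⟨ Σℤ-select N i (λ j j≢i → cong (_* b j τ) (if-dec-no (j Fin.≟ i) j≢i)) ⟩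
    δ i * b i τ ≡⟨ cong (_* b i τ) (if-dec-yes (i Fin.≟ i) refl) ⟩
    + 1 * b i τ ≡⟨ ℤ.*-identityˡ (b i τ) ⟩
    b i τ       ∎)
    where
    δ : Fin N → ℤ
    δ j = if does (j Fin.≟ i) then + 1 else + 0

  supported-expansion : ∀ {c} → SupportedOn L c →
                        ∀ τ → c τ ≡ Σℤ N (λ j → c (piv j) * unitChain (piv j) τ)
  supported-expansion {c} c-supp τ with τ ∈?ₛ L
  ... | yes τ∈L with pivot-surjective ps (pivots-cover τ∈L)
  ...   | k , refl = sym (begin
    Σℤ N (λ j → c (piv j) * unitChain (piv j) τ) ≡⟨ Σℤ-select N k off-k ⟩
    c τ * unitChain τ τ                          ≡⟨ cong (c τ *_) (unitChain-diag τ) ⟩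
    c τ * + 1                                    ≡⟨ ℤ.*-identityʳ (c τ) ⟩
    c τ                                          ∎)
    where
    off-k : ∀ j → j ≢ k → c (piv j) * unitChain (piv j) τ ≡ + 0
    off-k j j≢k = trans (cong (c (piv j) *_) (unitChain-offdiag (j≢k ∘ piv-injective)))
                        (ℤ.*-zeroʳ (c (piv j)))
  supported-expansion {c} c-supp τ | no τ∉L = trans (c-supp τ τ∉L) (sym (Σℤ-zero N vanish))
    where
    vanish : ∀ j → c (piv j) * unitChain (piv j) τ ≡ + 0
    vanish j = trans (unitChain-scaled c (piv j) τ) (cong (_* _) (c-supp τ τ∉L))

  span-supported : ∀ {c} → SupportedOn L c →
                   (∀ j → c (piv j) ≢ + 0 → InSpan (unitChain (piv j))) → InSpan c
  span-supported {c} c-supp spans = span-resp (supported-expansion c-supp) (span-Σ N _ term)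
    where
    term : ∀ j → InSpan (λ τ → c (piv j) * unitChain (piv j) τ)
    term j with c (piv j) ℤ.≟ + 0
    ... | yes c≡0 = span-resp (λ τ → cong (_* unitChain (piv j) τ) c≡0) span-zero
    ... | no  c≢0 = span-scale (c (piv j)) (spans j c≢0)

  -- unitChain (piv i) = u b_i + rest with u = b_i (piv i) = ±1, and rest vanishes at piv i,
  -- so it is supported on pivots below piv i.
  span-unit : ∀ i → InSpan (unitChain (piv i))
  span-unit i = go i (spo-wellFounded ⊏-isStrictPartialOrder i)
    where
    go : ∀ i → Acc _⊏_ i → InSpan (unitChain (piv i))
    go i (acc below) =
      span-resp split (span-+ (span-scale u (span-member i)) (span-supported rest-supported rest-spans))
      where
      u = b i (piv i)

      rest : Chain
      rest τ = unitChain (piv i) τ - u * b i τ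

      split : ∀ τ → unitChain (piv i) τ ≡ u * b i τ + rest τ
      split τ = y≡x+[y-x] (unitChain (piv i) τ) (u * b i τ)
        where
        y≡x+[y-x] : ∀ y x → y ≡ x + (y - x)
        y≡x+[y-x] = solve-∀

      rest-off : ∀ {τ} → τ ≢ piv i → rest τ ≡ - (u * b i τ)
      rest-off {τ} τ≢ = trans (cong (_- (u * b i τ)) (unitChain-offdiag (τ≢ ∘ sym)))
                              (ℤ.+-identityˡ (- (u * b i τ)))

      rest-vanishes : ∀ {τ} → τ ≢ piv i → b i τ ≡ + 0 → rest τ ≡ + 0
      rest-vanishes τ≢ b≡0 =
        trans (rest-off τ≢) (trans (cong (λ x → - (u * x)) b≡0) (cong -_ (ℤ.*-zeroʳ u)))

      rest-supported : SupportedOn L rest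
      rest-supported τ τ∉L =
        rest-vanishes (λ { refl → τ∉L (piv∈L i) }) (supported i τ τ∉L)

      rest-spans : ∀ j → rest (piv j) ≢ + 0 → InSpan (unitChain (piv j))
      rest-spans j rest≢0 with j Fin.≟ i
      ... | yes refl = contradiction (cong₂ _-_ (unitChain-diag (piv i)) (unit-at-pivot i)) rest≢0
      ... | no  j≢i  = go j (below (below-pivot i (piv j) (j≢i ∘ piv-injective) b≢0))
        where
        b≢0 : b i (piv j) ≢ + 0
        b≢0 = rest≢0 ∘ rest-vanishes (j≢i ∘ piv-injective)

  -- Evaluated at piv i, the relation keeps only its i-th term: every other b_j that is nonzero
  -- there has its pivot above piv i, so λs j = 0 by Noetherian induction.
  independent : ∀ (λs : Fin N → ℤ) → (∀ τ → Σℤ N (λ i → λs i * b i τ) ≡ + 0) →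
                ∀ i → λs i ≡ + 0
  independent λs Σ≡0 i = go i (spo-noetherian ⊏-isStrictPartialOrder i)
    where
    go : ∀ i → Acc (flip _⊏_) i → λs i ≡ + 0
    go i (acc above) = begin
      λs i            ≡⟨ ℤ.*-identityʳ (λs i) ⟨
      λs i * + 1      ≡⟨ cong (λs i *_) (unit-at-pivot i) ⟨
      λs i * (u * u)  ≡⟨ ℤ.*-assoc (λs i) u u ⟨
      λs i * u * u    ≡⟨ cong (_* u) (trans (sym (Σℤ-select N i others)) (Σ≡0 (piv i))) ⟩
      + 0 * u         ≡⟨⟩
      + 0             ∎
      where
      u = b i (piv i)
      others : ∀ j → j ≢ i → λs j * b j (piv i) ≡ + 0
      others j j≢i with b j (piv i) ℤ.≟ + 0
      ... | yes b≡0 = trans (cong (λs j *_) b≡0) (ℤ.*-zeroʳ (λs j))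
      ... | no  b≢0 = cong (_* b j (piv i))
        (go j (above (below-pivot j (piv i) (j≢i ∘ piv-injective ∘ sym) b≢0)))

  isBasis : IsBasis L (map proj₂ ps)
  isBasis = All.map⁺ (All.tabulate λ {(σ , c)} σ,c∈ → PivotedAt.supported (pivoted σ,c∈))
          , (λ c c-supp → span-supported c-supp λ j _ → span-unit j)
          , independent

removeAt-⊆ : ∀ (β : Simplex) k → removeAt β k ⊆ β
removeAt-⊆ (x ∷ β) zero    = x ∷ʳ ⊆-refl
removeAt-⊆ (x ∷ β) (suc k) = refl ∷ removeAt-⊆ β k

facet⇒removeAt : ∀ {α β} → α ⊆ β → length β ≡ suc (length α) → ∃ λ k → α ≡ removeAt β k
facet⇒removeAt (y ∷ʳ α⊆β)   |β|≡ =
  zero , Pointwise-≡⇒≡ (toPointwise (sym (ℕ.suc-injective |β|≡)) α⊆β)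
facet⇒removeAt (refl ∷ α⊆β) |β|≡ with facet⇒removeAt α⊆β (ℕ.suc-injective |β|≡)
... | k , α≡ = suc k , cong (_ ∷_) α≡

removeAt-injective : ∀ {β} → IsSimplex β → ∀ {j k} → removeAt β j ≡ removeAt β k → j ≡ k
removeAt-injective {x ∷ β}     _                {zero}  {zero}  _  = refl
removeAt-injective {x ∷ y ∷ β} ((x<y ∷ _) ∷ _) {zero}  {suc k} eq =
  contradiction x<y (ℕ.<-irrefl (sym (∷-injectiveˡ eq)))
removeAt-injective {x ∷ y ∷ β} ((x<y ∷ _) ∷ _) {suc j} {zero}  eq =
  contradiction x<y (ℕ.<-irrefl (∷-injectiveˡ eq))
removeAt-injective {x ∷ β}     (_ ∷ β↑)        {suc j} {suc k} eq =
  cong suc (removeAt-injective β↑ (∷-injectiveʳ eq))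

incidence-nonzero : ∀ β τ → incidence β τ ≢ + 0 → ∃ λ k → τ ≡ removeAt β k
incidence-nonzero β τ inc≢0 with Σℤ-nonzero (length β) inc≢0
... | k , term≢0 = k , if-dec-nonzero (τ ≟ₛ removeAt β k) term≢0

sign-squared : ∀ k → (- + 1) ^ k * (- + 1) ^ k ≡ + 1
sign-squared zero    = refl
sign-squared (suc k) = trans (cancel ((- + 1) ^ k)) (sign-squared k)
  where
  cancel : ∀ x → (- + 1 * x) * (- + 1 * x) ≡ x * x
  cancel = solve-∀

incidence-facet² : ∀ {α β} → IsSimplex β → IsFacet α β → incidence β α * incidence β α ≡ + 1
incidence-facet² {α} {β} β↑ (α⊆β , |β|≡) with facet⇒removeAt α⊆β |β|≡
... | k , α≡ = trans (cong (λ x → x * x) incidence≡sign) (sign-squared (toℕ k))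
  where
  other-terms : ∀ j → j ≢ k → (if does (α ≟ₛ removeAt β j) then (- + 1) ^ toℕ j else + 0) ≡ + 0
  other-terms j j≢k = if-dec-no (α ≟ₛ removeAt β j)
    λ α≡′ → j≢k (removeAt-injective β↑ (trans (sym α≡′) α≡))

  incidence≡sign : incidence β α ≡ (- + 1) ^ toℕ k
  incidence≡sign = trans (Σℤ-select (length β) k other-terms) (if-dec-yes (α ≟ₛ removeAt β k) α≡)

module Trajectories (V : List Pair) where

  extensions : ℕ → Simplex → List (List Pair)
  extensions zero    β = []
  extensions (suc n) β =
    concatMap (λ p → map (p ∷_) (trajectories V n (proj₂ p))) (filter (stepOK? β) V)

  trajectories-unfold : ∀ n β → trajectories V n β ≡ [] ∷ extensions n β
  trajectories-unfold zero    β = refl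
  trajectories-unfold (suc n) β = refl

  trajectories-sound : ∀ n {β ps} → ps ∈ trajectories V n β → IsTrajectory V β ps
  extensions-sound   : ∀ n {β ps} → ps ∈ extensions n β →
                       ∃₂ λ p ps′ → ps ≡ p ∷ ps′ × IsTrajectory V β ps

  trajectories-sound zero    (here refl) = tt
  trajectories-sound (suc n) (here refl) = tt
  trajectories-sound (suc n) (there ps∈) with extensions-sound (suc n) ps∈
  ... | _ , _ , refl , t = t

  extensions-sound (suc n) {β} ps∈
    with find (∈-concatMap⁻ (λ p → map (p ∷_) (trajectories V n (proj₂ p)))
                            {xs = filter (stepOK? β) V} ps∈)
  ... | (α , β′) , p∈ , ps∈′ with ∈-filter⁻ (stepOK? β) {xs = V} p∈ | map∷⁻ ps∈′
  ...   | p∈V , step | ps′ , ps′∈ , refl =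
    (α , β′) , ps′ , refl , p∈V , step , trajectories-sound n ps′∈

  terminal-length : ∀ {β} ps → IsTrajectory V β ps → length (terminal β ps) ≡ length β
  terminal-length []              _                             = refl
  terminal-length ((α , β′) ∷ ps) (_ , (_ , _ , _ , |β′|≡) , t) = trans (terminal-length ps t) |β′|≡

  terminal-target : ∀ {β} p ps → IsTrajectory V β (p ∷ ps) →
                    Any (λ p′ → proj₂ p′ ≡ terminal β (p ∷ ps)) V
  terminal-target p        []               (p∈V , _) = lose p∈V refl
  terminal-target (α , β′) ((α′ , β″) ∷ ps) (_ , _ , t) = terminal-target (α′ , β″) ps t

  terminal-++ : ∀ β ps qs → terminal β (ps ++ qs) ≡ terminal (terminal β ps) qs
  terminal-++ β []              qs = refl
  terminal-++ β ((α , β′) ∷ ps) qs = terminal-++ β′ ps qs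

  trajectory-++ : ∀ {β} ps {qs} → IsTrajectory V β ps → IsTrajectory V (terminal β ps) qs →
                  IsTrajectory V β (ps ++ qs)
  trajectory-++ []              _                 t′ = t′
  trajectory-++ ((α , β′) ∷ ps) (p∈V , step , t) t′ = p∈V , step , trajectory-++ ps t t′

  _⇝_ : Rel Simplex 0ℓ
  β ⇝ β′ = ∃₂ λ p ps → IsTrajectory V β (p ∷ ps) × terminal β (p ∷ ps) ≡ β′

  ⇝-trans : Transitive _⇝_
  ⇝-trans {β} (p , ps , t , refl) (p′ , ps′ , t′ , refl) =
    p , ps ++ p′ ∷ ps′ , trajectory-++ (p ∷ ps) t t′ , terminal-++ β (p ∷ ps) (p′ ∷ ps′)

  ⇝-isStrictPartialOrder : IsGradient V → IsStrictPartialOrder _≡_ _⇝_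
  ⇝-isStrictPartialOrder gradient = record
    { isEquivalence = isEquivalence
    ; irrefl        = λ { {β} refl (p , ps , t , closed) → gradient β p ps t closed }
    ; trans         = ⇝-trans
    ; <-resp-≈      = resp₂ _⇝_
    }

  ⇝-target : ∀ {β β′} → β ⇝ β′ → Any (λ p → proj₂ p ≡ β′) V
  ⇝-target (p , ps , t , refl) = terminal-target p ps t

  ⇝-length : ∀ {β β′} → β ⇝ β′ → length β′ ≡ length β
  ⇝-length (p , ps , t , refl) = terminal-length (p ∷ ps) t

  arrow-diag : IsGradient V → ∀ σ → arrow V σ σ ≡ + 1
  arrow-diag gradient σ rewrite trajectories-unfold (length V) σ =
    cong₂ _+_ (if-dec-yes (σ ≟ₛ σ) refl) (sumℤ-map-zero (All.tabulate not-closed))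
    where
    not-closed : ∀ {ps} → ps ∈ extensions (length V) σ →
                 (if does (terminal σ ps ≟ₛ σ) then weight σ ps else + 0) ≡ + 0
    not-closed ps∈ with extensions-sound (length V) ps∈
    ... | p , ps , refl , t = if-dec-no (terminal σ (p ∷ ps) ≟ₛ σ) (gradient σ p ps t)

  arrow-offdiag : ∀ {σ τ} → τ ≢ σ → arrow V σ τ ≢ + 0 → σ ⇝ τ
  arrow-offdiag {σ} {τ} τ≢σ arrow≢0
    with find (sumℤ-map-nonzero (trajectories V (length V) σ) arrow≢0)
  ... | ps , ps∈ , term≢0
    with ps | trajectories-sound (length V) ps∈ | if-dec-nonzero (terminal σ ps ≟ₛ τ) term≢0
  ...   | []      | _ | σ≡τ = contradiction (sym σ≡τ) τ≢σ
  ...   | p ∷ ps′ | t | ends = p , ps′ , t , ends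

module VectorField (K : List Simplex) (isK : IsComplex K) (V : List Pair) (dvf : IsDVF K V) where

  open IsDVF dvf
  open Trajectories V

  IsSource : Simplex → Set
  IsSource τ = Any (λ p → proj₁ p ≡ τ) V

  IsTarget : Simplex → Set
  IsTarget τ = Any (λ p → proj₂ p ≡ τ) V

  source? : ∀ τ → Dec (IsSource τ)
  source? τ = any? (λ p → proj₁ p ≟ₛ τ) V

  target? : ∀ τ → Dec (IsTarget τ)
  target? τ = any? (λ p → proj₂ p ≟ₛ τ) V

  noncriticalTarget? : ∀ τ → Dec (¬ Critical V τ × IsTarget τ)
  noncriticalTarget? τ = ¬? (critical? V τ) ×-dec target? τ

  pair-facet : ∀ {p} → p ∈ V → IsFacet (proj₁ p) (proj₂ p)
  pair-facet = All.lookup facet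

  pair-∈K : ∀ {p} → p ∈ V → proj₁ p ∈ K × proj₂ p ∈ K
  pair-∈K = All.lookup inK

  source≢target : ∀ {p p′} → p ∈ V → p′ ∈ V → proj₁ p ≢ proj₂ p′
  source≢target {p} p∈ p′∈ eq with atMostOne p∈ p′∈ (inj₂ (inj₁ eq))
  ... | refl = ℕ.1+n≢n (sym (trans (cong length eq) (proj₂ (pair-facet p∈))))

  ¬source×target : ∀ {τ} → IsSource τ → ¬ IsTarget τ
  ¬source×target source target with find source | find target
  ... | _ , p∈ , refl | _ , p′∈ , eq = source≢target p∈ p′∈ (sym eq)

  Vof-pair : ∀ {α β} → (α , β) ∈ V → Vof V α ≡ β
  Vof-pair {α} {β} α,β∈ = go V (All.tabulate id) α,β∈
    where
    go : ∀ W → All (_∈ V) W → (α , β) ∈ W → Vof W α ≡ β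
    go ((α′ , β′) ∷ W) _               (here refl)   = if-dec-yes (α ≟ₛ α) refl
    go ((α′ , β′) ∷ W) (α′,β′∈ ∷ W⊆V) (there α,β∈W) with α′ ≟ₛ α
    ... | yes α′≡α = cong proj₂ (atMostOne α′,β′∈ α,β∈ (inj₁ α′≡α))
    ... | no  _    = go W W⊆V α,β∈W

  source-pair : ∀ {α} → IsSource α → (α , Vof V α) ∈ V
  source-pair source with find source
  ... | (α , β) , α,β∈ , refl = subst (λ β′ → (α , β′) ∈ V) (sym (Vof-pair α,β∈)) α,β∈

  InNoPair⇒¬source : ∀ {τ} → InNoPair V τ → ¬ IsSource τ
  InNoPair⇒¬source noPair source with find source
  ... | _ , p∈ , eq = proj₁ (All.lookup noPair p∈) eq

  InNoPair⇒¬target : ∀ {τ} → InNoPair V τ → ¬ IsTarget τ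
  InNoPair⇒¬target noPair target with find target
  ... | _ , p∈ , eq = proj₂ (All.lookup noPair p∈) eq

  critical⇒¬source : ∀ {σ} → Critical V σ → ¬ IsSource σ
  critical⇒¬source (_ , inj₁ noPair)            = InNoPair⇒¬source noPair
  critical⇒¬source (_ , inj₂ (_ , ∅,σ∈)) source = ¬source×target source (lose ∅,σ∈ refl)

  -- A critical vertex σ with (∅, σ) ∈ V starts no trajectory: its only facet ∅ is paired with σ.
  critical-⇝⇒InNoPair : ∀ {σ τ} → Critical V σ → σ ⇝ τ → InNoPair V σ
  critical-⇝⇒InNoPair (_ , inj₁ noPair) _ = noPair
  critical-⇝⇒InNoPair (_ , inj₂ (|σ|≡1 , ∅,σ∈))
                      ((α , β) , _ , (α,β∈ , (_ , _ , σ≢β , |β|≡|σ|) , _) , _) =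
    contradiction (cong proj₂ (atMostOne α,β∈ ∅,σ∈ (inj₁ α≡∅))) (σ≢β ∘ sym)
    where
    empty : ∀ {xs : Simplex} → length xs ≡ 0 → xs ≡ []
    empty {[]} _ = refl

    α≡∅ : α ≡ []
    α≡∅ = empty (ℕ.suc-injective (trans (sym (proj₂ (pair-facet α,β∈))) (trans |β|≡|σ| |σ|≡1)))

  rank : Simplex → ℕ
  rank τ with source? τ | target? τ
  ... | yes _ | _     = 2
  ... | no  _ | yes _ = 0
  ... | no  _ | no  _ = 1

  rank-source : ∀ {τ} → IsSource τ → rank τ ≡ 2
  rank-source {τ} source with source? τ
  ... | yes _       = refl
  ... | no  ¬source = contradiction source ¬source

  rank-¬source : ∀ {τ} → ¬ IsSource τ → rank τ < 2
  rank-¬source {τ} ¬source with source? τ | target? τ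
  ... | yes source | _     = contradiction source ¬source
  ... | no  _      | yes _ = ℕ.z<s
  ... | no  _      | no  _ = ℕ.s<s ℕ.z<s

  rank-target : ∀ {τ} → IsTarget τ → rank τ ≡ 0
  rank-target {τ} target with source? τ | target? τ
  ... | yes source | _          = contradiction target (¬source×target source)
  ... | no  _      | yes _      = refl
  ... | no  _      | no ¬target = contradiction target ¬target

  rank-InNoPair : ∀ {τ} → InNoPair V τ → rank τ ≡ 1
  rank-InNoPair {τ} noPair with source? τ | target? τ
  ... | yes source | _          = contradiction source (InNoPair⇒¬source noPair)
  ... | no  _      | yes target = contradiction target (InNoPair⇒¬target noPair)
  ... | no  _      | no  _      = refl

  -- Vof V τ is junk unless τ is a source, the only rank at which it gets compared.
  key : Simplex → ℕ × Simplex
  key τ = rank τ , Vof V τ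

  _≺_ : Rel Simplex 0ℓ
  _≺_ = ×-Lex _≡_ _<_ (flip _⇝_) on key

  ≺-isStrictPartialOrder : IsGradient V → IsStrictPartialOrder (Pointwise _≡_ _≡_ on key) _≺_
  ≺-isStrictPartialOrder gradient = On.isStrictPartialOrder key
    (×-isStrictPartialOrder ℕ.<-isStrictPartialOrder
                            (Flip.isStrictPartialOrder (⇝-isStrictPartialOrder gradient)))

  source-facet-⇝ : ∀ {α τ} → IsSource α → IsSource τ →
                   τ ⊆ Vof V α → length τ ≡ length α → τ ≢ α → Vof V α ⇝ Vof V τ
  source-facet-⇝ {α} {τ} source-α source-τ τ⊆ |τ|≡|α| τ≢α =
    (τ , Vof V τ) , [] , (source-pair source-τ , (τ⊆ , τ≢Vα , Vα≢Vτ , |Vτ|≡|Vα|) , tt) , refl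
    where
    |Vα| : length (Vof V α) ≡ suc (length α)
    |Vα| = proj₂ (pair-facet (source-pair source-α))

    τ≢Vα : τ ≢ Vof V α
    τ≢Vα τ≡ = ℕ.1+n≢n (trans (sym |Vα|) (trans (cong length (sym τ≡)) |τ|≡|α|))

    Vα≢Vτ : Vof V α ≢ Vof V τ
    Vα≢Vτ eq = τ≢α (sym (cong proj₁
      (atMostOne (source-pair source-α) (source-pair source-τ) (inj₂ (inj₂ (inj₂ eq))))))

    |Vτ|≡|Vα| : length (Vof V τ) ≡ length (Vof V α)
    |Vτ|≡|Vα| =
      trans (proj₂ (pair-facet (source-pair source-τ))) (trans (cong suc |τ|≡|α|) (sym |Vα|))

  module _ (q : ℕ) where

    ∈S⁻ : ∀ {τ} → τ ∈ S K q → τ ∈ K × length τ ≡ suc q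
    ∈S⁻ = ∈-filter⁻ (λ σ → length σ ℕ.≟ suc q) {xs = K}

    ∈S⁺ : ∀ {τ} → τ ∈ K → length τ ≡ suc q → τ ∈ S K q
    ∈S⁺ = ∈-filter⁺ (λ σ → length σ ℕ.≟ suc q)

    ∈Crit⁻ : ∀ {σ} → σ ∈ Crit K V q → σ ∈ S K q × Critical V σ
    ∈Crit⁻ = ∈-filter⁻ (critical? V) {xs = S K q}

    ∈U⁻ : ∀ {α} → α ∈ U K V q → α ∈ S K q × IsSource α
    ∈U⁻ = ∈-filter⁻ source? {xs = S K q}

    ∈D⁻ : ∀ {β} → β ∈ D K V q → β ∈ S K q × ¬ Critical V β × IsTarget β
    ∈D⁻ = ∈-filter⁻ noncriticalTarget? {xs = S K q}

    Crit-U-disjoint : Disjoint (Crit K V q) (U K V q)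
    Crit-U-disjoint (σ∈Crit , σ∈U) = critical⇒¬source (proj₂ (∈Crit⁻ σ∈Crit)) (proj₂ (∈U⁻ σ∈U))

    U-D-disjoint : Disjoint (U K V q) (D K V q)
    U-D-disjoint (σ∈U , σ∈D) = ¬source×target (proj₂ (∈U⁻ σ∈U)) (proj₂ (proj₂ (∈D⁻ σ∈D)))

    Crit-U++D-disjoint : Disjoint (Crit K V q) (U K V q ++ D K V q)
    Crit-U++D-disjoint (σ∈Crit , σ∈U++D) with ∈-++⁻ (U K V q) σ∈U++D
    ... | inj₁ σ∈U = Crit-U-disjoint (σ∈Crit , σ∈U)
    ... | inj₂ σ∈D = proj₁ (proj₂ (∈D⁻ σ∈D)) (proj₂ (∈Crit⁻ σ∈Crit))

    classify : ∀ {τ} → τ ∈ S K q → τ ∈ Crit K V q ++ U K V q ++ D K V q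
    classify {τ} τ∈S with critical? V τ | source? τ | target? τ
    ... | yes critical  | _          | _          =
      ∈-++⁺ˡ (∈-filter⁺ (critical? V) τ∈S critical)
    ... | no  _         | yes source | _          =
      ∈-++⁺ʳ (Crit K V q) (∈-++⁺ˡ (∈-filter⁺ source? τ∈S source))
    ... | no  ¬critical | no  _      | yes target =
      ∈-++⁺ʳ (Crit K V q) (∈-++⁺ʳ (U K V q) (∈-filter⁺ noncriticalTarget? τ∈S (¬critical , target)))
    ... | no  ¬critical | no ¬source | no ¬target = contradiction (τ≢∅ , inj₁ noPair) ¬critical
      where
      τ≢∅ : τ ≢ []
      τ≢∅ τ≡∅ = ℕ.0≢1+n (trans (sym (cong length τ≡∅)) (proj₂ (∈S⁻ τ∈S)))

      noPair : InNoPair V τ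
      noPair = All.tabulate λ p∈ → ¬source ∘ lose p∈ , ¬target ∘ lose p∈

    pivoted : List (Simplex × Chain)
    pivoted = tagged (arrow V) (Crit K V q)
           ++ tagged (boundary K q ∘ Vof V) (U K V q)
           ++ tagged unitChain (D K V q)

    pivoted-pivots : map proj₁ pivoted ≡ Crit K V q ++ U K V q ++ D K V q
    pivoted-pivots = trans (map-++ proj₁ (tagged (arrow V) (Crit K V q)) _)
      (cong₂ _++_ (map-proj₁-tagged (arrow V) (Crit K V q))
        (trans (map-++ proj₁ (tagged (boundary K q ∘ Vof V) (U K V q)) _)
          (cong₂ _++_ (map-proj₁-tagged (boundary K q ∘ Vof V) (U K V q))
                      (map-proj₁-tagged unitChain (D K V q)))))

    pivoted-chains : map proj₂ pivoted ≡ Stilde K V q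
    pivoted-chains = trans (map-++ proj₂ (tagged (arrow V) (Crit K V q)) _)
      (cong₂ _++_ (map-proj₂-tagged (arrow V) (Crit K V q))
        (trans (map-++ proj₂ (tagged (boundary K q ∘ Vof V) (U K V q)) _)
          (cong₂ _++_ (map-proj₂-tagged (boundary K q ∘ Vof V) (U K V q))
                      (map-proj₂-tagged unitChain (D K V q)))))

    pivots-unique : Unique (map proj₁ pivoted)
    pivots-unique = subst Unique (sym pivoted-pivots)
      (Unique.++⁺ (Unique.filter⁺ _ S-unique)
                  (Unique.++⁺ (Unique.filter⁺ _ S-unique) (Unique.filter⁺ _ S-unique) U-D-disjoint)
                  Crit-U++D-disjoint)
      where
      S-unique : Unique (S K q)
      S-unique = Unique.filter⁺ _ (IsComplex.noDup isK)

    pivots-cover : ∀ {τ} → τ ∈ S K q → τ ∈ map proj₁ pivoted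
    pivots-cover τ∈S = subst (_ ∈_) (sym pivoted-pivots) (classify τ∈S)

    ⇝-closed : ∀ {σ τ} → σ ∈ S K q → σ ⇝ τ → τ ∈ S K q
    ⇝-closed σ∈S σ⇝τ with find (⇝-target σ⇝τ)
    ... | p , p∈ , refl = ∈S⁺ (proj₂ (pair-∈K p∈)) (trans (⇝-length σ⇝τ) (proj₂ (∈S⁻ σ∈S)))

    arrow-pivoted : IsGradient V → ∀ {σ} → σ ∈ Crit K V q → PivotedAt (S K q) _≺_ σ (arrow V σ)
    arrow-pivoted gradient {σ} σ∈Crit = record
      { supported     = supported
      ; unit-at-pivot = cong₂ _*_ (arrow-diag gradient σ) (arrow-diag gradient σ)
      ; below-pivot   = below
      }
      where
      σ∈S = proj₁ (∈Crit⁻ σ∈Crit)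

      supported : SupportedOn (S K q) (arrow V σ)
      supported τ τ∉S with arrow V σ τ ℤ.≟ + 0
      ... | yes arrow≡0 = arrow≡0
      ... | no  arrow≢0 =
        contradiction (⇝-closed σ∈S (arrow-offdiag (λ { refl → τ∉S σ∈S }) arrow≢0)) τ∉S

      below : ∀ τ → τ ≢ σ → arrow V σ τ ≢ + 0 → τ ≺ σ
      below τ τ≢σ arrow≢0 = inj₁ (subst₂ _<_
        (sym (rank-target (⇝-target σ⇝τ)))
        (sym (rank-InNoPair (critical-⇝⇒InNoPair (proj₂ (∈Crit⁻ σ∈Crit)) σ⇝τ)))
        ℕ.z<s)
        where
        σ⇝τ = arrow-offdiag τ≢σ arrow≢0

    boundary-pivoted : ∀ {α} → α ∈ U K V q → PivotedAt (S K q) _≺_ α (boundary K q (Vof V α))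
    boundary-pivoted {α} α∈U = record
      { supported     = λ τ → if-dec-no (τ ∈?ₛ S K q)
      ; unit-at-pivot = trans (cong (λ x → x * x) (boundary-on-S α∈S))
                              (incidence-facet² Vα-simplex (pair-facet α,Vα∈))
      ; below-pivot   = below
      }
      where
      α∈S = proj₁ (∈U⁻ α∈U)
      source-α = proj₂ (∈U⁻ α∈U)
      α,Vα∈ = source-pair source-α

      Vα-simplex : IsSimplex (Vof V α)
      Vα-simplex = All.lookup (IsComplex.simplices isK) (proj₂ (pair-∈K α,Vα∈))

      boundary-on-S : ∀ {τ} → τ ∈ S K q → boundary K q (Vof V α) τ ≡ incidence (Vof V α) τ
      boundary-on-S {τ} = if-dec-yes (τ ∈?ₛ S K q)

      below : ∀ τ → τ ≢ α → boundary K q (Vof V α) τ ≢ + 0 → τ ≺ α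
      below τ τ≢α ∂≢0 = by-source (source? τ)
        where
        τ∈S = if-dec-nonzero (τ ∈?ₛ S K q) ∂≢0

        |τ|≡|α| : length τ ≡ length α
        |τ|≡|α| = trans (proj₂ (∈S⁻ τ∈S)) (sym (proj₂ (∈S⁻ α∈S)))

        τ⊆ : τ ⊆ Vof V α
        τ⊆ with incidence-nonzero (Vof V α) τ (∂≢0 ∘ trans (boundary-on-S τ∈S))
        ... | k , refl = removeAt-⊆ (Vof V α) k

        by-source : Dec (IsSource τ) → τ ≺ α
        by-source (yes source-τ) =
          inj₂ ( trans (rank-source source-τ) (sym (rank-source source-α))
               , source-facet-⇝ source-α source-τ τ⊆ |τ|≡|α| τ≢α )
        by-source (no ¬source-τ) =
          inj₁ (subst (rank τ <_) (sym (rank-source source-α)) (rank-¬source ¬source-τ))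

    unitChain-pivoted : ∀ {β} → β ∈ D K V q → PivotedAt (S K q) _≺_ β (unitChain β)
    unitChain-pivoted {β} β∈D = record
      { supported     = λ τ τ∉S → unitChain-offdiag {β} {τ} λ { refl → τ∉S (proj₁ (∈D⁻ β∈D)) }
      ; unit-at-pivot = cong₂ _*_ (unitChain-diag β) (unitChain-diag β)
      ; below-pivot   = λ τ τ≢β unit≢0 → contradiction (unitChain-offdiag (τ≢β ∘ sym)) unit≢0
      }

    pivoted-at : IsGradient V → ∀ {σ c} → (σ , c) ∈ pivoted → PivotedAt (S K q) _≺_ σ c
    pivoted-at gradient σ,c∈ with ∈-++⁻ (tagged (arrow V) (Crit K V q)) σ,c∈
    ... | inj₁ ∈arrows with ∈-tagged⁻ ∈arrows
    ...   | σ∈Crit , refl = arrow-pivoted gradient σ∈Crit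
    pivoted-at gradient σ,c∈ | inj₂ ∈rest with ∈-++⁻ (tagged (boundary K q ∘ Vof V) (U K V q)) ∈rest
    ... | inj₁ ∈boundaries with ∈-tagged⁻ ∈boundaries
    ...   | α∈U , refl = boundary-pivoted α∈U
    pivoted-at gradient σ,c∈ | inj₂ ∈rest | inj₂ ∈units with ∈-tagged⁻ ∈units
    ...   | β∈D , refl = unitChain-pivoted β∈D

lemma3p1 : (K : List Simplex) → IsComplex K → (d : ℕ) → HasDim K d →
    (V : List Pair) → IsDVF K V → IsGradient V →
    (q : ℕ) → q ≤ d → IsBasis (S K q) (Stilde K V q)
lemma3p1 K isK d _ V dvf gradient q _ =
  subst (IsBasis (S K q)) (pivoted-chains q)
    (Unitriangular.isBasis (≺-isStrictPartialOrder gradient) (S K q) (pivoted q)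
      (pivots-unique q) (pivots-cover q) (pivoted-at q gradient))
  where
  open VectorField K isK V dvf
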